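{- Let $\Omega$ be a set of size $n\geqslant4096$, $\alpha\in\Omega$, and let $G$ be a primitive $2$-closed permutation group on $\Omega$ of rank $4$ that is not the automorphism group of any graph or digraph of order $n$. Let $\{\alpha\},B_1,B_2,B_3$ be the orbits of $G_\alpha$ on $\Omega$, let $E_i=\{(\alpha,\beta)^g: g\in G,\beta\in B_i\}$ and $\Gamma_i=(\Omega,E_i)$ for $i=1,2,3$. Then for each $i\in\{1,2,3\}$: (1) $\mathrm{Aut}(\Gamma_i)$ is primitive of rank $3$, and the orbits of $\mathrm{Aut}(\Gamma_i)_\alpha$ are $\{\alpha\}$, $B_i$ and $\bigcup_{j\neq i}B_j$; (2) $\Gamma_i$ is a (undirected) distance-transitive graph of order $n$ and diameter $2$.
   Context: A permutation group is $2$-closed if it equals the largest subgroup of the symmetric group having the same orbits on ordered pairs; the rank is the number of orbits on $\Omega\times\Omega$. A graph is distance-transitive if its automorphism group is transitive on ordered pairs of vertices at distance $i$ for each $i\geqslant0$. -}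

module Defs where

open import Data.Nat using (ℕ; zero; suc; _≤_; _<_)
open import Data.Fin using (Fin)
open import Data.Fin.Permutation using (Permutation′; _⟨$⟩ʳ_; _∘ₚ_; flip; id; _≈_)
open import Data.Fin.Subset using (Subset; _∈_; _∉_; ∣_∣)
open import Data.Bool using (Bool; false)
open import Data.Product using (Σ; ∃; ∃-syntax; _×_; _,_)
open import Data.Sum using (_⊎_)
open import Relation.Nullary using (¬_)
open import Relation.Binary.PropositionalEquality using (_≡_)
open import Function.Bundles using (_⇔_)

-- Ω = Fin n.  A "permutation group" is given by its membership predicate on
-- Sym(Ω) = Permutation′ n together with the subgroup axioms.
PermPred : ℕ → Set₁
PermPred n = Permutation′ n → Set

record IsPermGroup {n : ℕ} (G : PermPred n) : Set where
  field
    resp   : ∀ {g h} → g ≈ h → G g → G h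
    has-id : G id
    closed : ∀ {g h} → G g → G h → G (g ∘ₚ h)
    inv    : ∀ {g} → G g → G (flip g)

PairRel : {n : ℕ} → PermPred n → Fin n × Fin n → Fin n × Fin n → Set
PairRel G (a , b) (c , d) = ∃[ g ] (G g × g ⟨$⟩ʳ a ≡ c × g ⟨$⟩ʳ b ≡ d)

-- G has exactly r orbits on Ω × Ω (rank r): r pairwise inequivalent
-- representatives covering Ω × Ω.
HasRank : {n : ℕ} → PermPred n → ℕ → Set
HasRank {n} G r =
  Σ (Fin r → Fin n × Fin n) λ rep →
    (∀ i j → PairRel G (rep i) (rep j) → i ≡ j) ×
    (∀ p → ∃[ i ] PairRel G p (rep i))

Transitive : {n : ℕ} → PermPred n → Set
Transitive {n} G = ∀ (a b : Fin n) → ∃[ g ] (G g × g ⟨$⟩ʳ a ≡ b)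

-- B is a block: for each g ∈ G, either B^g ⊆ B (hence B^g = B) or B^g ∩ B = ∅
IsBlock : {n : ℕ} → PermPred n → Subset n → Set
IsBlock G B = ∀ g → G g →
  (∀ x → x ∈ B → g ⟨$⟩ʳ x ∈ B) ⊎ (∀ x → x ∈ B → g ⟨$⟩ʳ x ∉ B)

Primitive : {n : ℕ} → PermPred n → Set
Primitive {n} G = Transitive G × (∀ B → IsBlock G B → ∣ B ∣ ≤ 1 ⊎ ∣ B ∣ ≡ n)

TwoClosed : {n : ℕ} → PermPred n → Set
TwoClosed {n} G = ∀ π → (∀ a b → PairRel G (a , b) (π ⟨$⟩ʳ a , π ⟨$⟩ʳ b)) → G π

AutB : {n : ℕ} → (Fin n → Fin n → Bool) → PermPred n
AutB E π = ∀ x y → E x y ≡ E (π ⟨$⟩ʳ x) (π ⟨$⟩ʳ y)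

Aut : {n : ℕ} → (Fin n → Fin n → Set) → PermPred n
Aut E π = ∀ x y → E x y ⇔ E (π ⟨$⟩ʳ x) (π ⟨$⟩ʳ y)

-- G is the full automorphism group of some graph or digraph on Ω
-- (a loopless arc relation; a graph is a symmetric one)
IsAutOfDigraph : {n : ℕ} → PermPred n → Set
IsAutOfDigraph {n} G =
  ∃[ E ] ((∀ (x : Fin n) → E x x ≡ false) × (∀ π → G π ⇔ AutB E π))

StabOrb : {n : ℕ} → PermPred n → Fin n → Fin n → Fin n → Set
StabOrb H α x y = ∃[ h ] (H h × h ⟨$⟩ʳ α ≡ α × h ⟨$⟩ʳ x ≡ y)

Walk : {n : ℕ} → (Fin n → Fin n → Set) → ℕ → Fin n → Fin n → Set
Walk E zero x y = x ≡ y
Walk E (suc k) x y = ∃[ z ] (E x z × Walk E k z y)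

Dist : {n : ℕ} → (Fin n → Fin n → Set) → Fin n → Fin n → ℕ → Set
Dist E x y d = Walk E d x y × (∀ m → m < d → ¬ Walk E m x y)

HasDiameter : {n : ℕ} → (Fin n → Fin n → Set) → ℕ → Set
HasDiameter E D =
  (∀ x y → ∃[ d ] (d ≤ D × Dist E x y d)) × (∃[ x ] ∃[ y ] Dist E x y D)

UndirectedGraph : {n : ℕ} → (Fin n → Fin n → Set) → Set
UndirectedGraph {n} E = (∀ x y → E x y → E y x) × (∀ (x : Fin n) → ¬ E x x)

DistanceTransitive : {n : ℕ} → (Fin n → Fin n → Set) → Set
DistanceTransitive E = ∀ x y x′ y′ d → Dist E x y d → Dist E x′ y′ d →
  ∃[ π ] (Aut E π × π ⟨$⟩ʳ x ≡ x′ × π ⟨$⟩ʳ y ≡ y′)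

OrbitalGraph : {n : ℕ} → PermPred n → Fin n → (Fin n → Set) → Fin n → Fin n → Set
OrbitalGraph G α B x y = ∃[ g ] ∃[ β ] (G g × B β × g ⟨$⟩ʳ α ≡ x × g ⟨$⟩ʳ β ≡ y)

-- Let A = Aut(Γᵢ) ⊇ G.  If A_α did not fuse the two G_α-orbits Bⱼ, Bₗ (j, l ≠ i),
-- then A_α would fix every G_α-orbit setwise, so A would preserve every orbital of G
-- and, G being 2-closed, A = G: then G would be the automorphism group of the digraph Γᵢ.
-- Hence A_α has the three orbits {α}, Bᵢ and Bⱼ ∪ Bₗ.  The in-neighbours of α form one
-- G_α-orbit, which by the fusion can only be Bᵢ, so Γᵢ is undirected.  Finally, if α and
-- the points of Bⱼ ∪ Bₗ had no common neighbour, {α} ∪ Bᵢ would be closed under adjacency,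
-- hence a non-trivial block of G; so these points are at distance 2, the three orbits of
-- A_α are exactly the spheres around α, and Γᵢ is distance-transitive of diameter 2.
module Submission where

open import Defs
open import Data.Nat using (ℕ; zero; suc; _≥_; _<_; s≤s)
open import Data.Nat.Properties using (≤⇒≯; <-cmp)
open import Data.Fin using (Fin; zero; suc; toℕ; punchOut; punchIn)
open import Data.Fin.Properties using (_≟_; any?; all?; toℕ-injective; toℕ≤pred[n])
open import Data.Fin.Permutation
  using (Permutation′; _⟨$⟩ʳ_; _⟨$⟩ˡ_; _∘ₚ_; flip; id; _≈_; insert; remove; insert-remove; inverseˡ; inverseʳ)
open import Data.Fin.Subset using (Subset; _∈_; _∉_; ∣_∣; ⁅_⁆; ⊤; _⊂_)
open import Data.Fin.Subset.Properties using (∣p∣≡n⇒p≡⊤; ∈⊤; p⊂q⇒∣p∣<∣q∣; ∣⁅x⁆∣≡1; x∈⁅y⁆⇒x≡y; x≢y⇒x∉⁅y⁆)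
open import Data.Vec using (tabulate)
open import Data.Vec.Properties using (lookup∘tabulate; lookup⇒[]=; []=⇒lookup)
open import Data.Bool.Properties using (T-≡)
open import Data.Empty using (⊥; ⊥-elim)
open import Data.Product using (∃; ∃-syntax; _×_; _,_; proj₁; proj₂)
open import Data.Sum using (_⊎_; inj₁; inj₂)
open import Relation.Nullary using (¬_; Dec; yes; no; does)
open import Relation.Nullary.Decidable using (map′; _×-dec_; _⊎-dec_; _→-dec_; dec-true; dec-false; does-⇔; toWitness; isYes≗does)
open import Relation.Binary.Definitions using (tri<; tri≈; tri>)
open import Relation.Binary.PropositionalEquality using (_≡_; _≢_; refl; sym; trans; cong; subst; subst₂)
open import Function.Bundles using (_⇔_; mk⇔; module Equivalence)

open Equivalence using (to; from)

private
  variable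
    n : ℕ

⟨$⟩ʳ-injective : (π : Permutation′ n) {x y : Fin n} → π ⟨$⟩ʳ x ≡ π ⟨$⟩ʳ y → x ≡ y
⟨$⟩ʳ-injective π πx≡πy =
  trans (sym (inverseˡ π)) (trans (cong (π ⟨$⟩ˡ_) πx≡πy) (inverseˡ π))

flip-⟨$⟩ʳ : (π : Permutation′ n) {x y : Fin n} → π ⟨$⟩ʳ x ≡ y → flip π ⟨$⟩ʳ y ≡ x
flip-⟨$⟩ʳ π πx≡y = trans (cong (π ⟨$⟩ˡ_) (sym πx≡y)) (inverseˡ π)

insert-cong : ∀ {m} (i j : Fin (suc m)) {π ρ : Permutation′ m} → π ≈ ρ → insert i j π ≈ insert i j ρ
insert-cong i j π≈ρ k with i ≟ k
... | yes _  = refl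
... | no i≢k = cong (punchIn j) (π≈ρ (punchOut i≢k))

-- Every permutation of Fin (suc m) is insert zero j ρ for j its image of zero.
∃-Permutation? : ∀ m {P : Permutation′ m → Set} → (∀ {π ρ} → π ≈ ρ → P π → P ρ) →
                 (∀ π → Dec (P π)) → Dec (∃ P)
∃-Permutation? zero resp P? with P? id
... | yes p = yes (id , p)
... | no ¬p = no λ (π , p) → ¬p (resp (λ ()) p)
∃-Permutation? (suc m) resp P?
  with any? (λ j → ∃-Permutation? m (λ π≈ρ → resp (insert-cong zero j π≈ρ)) (λ ρ → P? (insert zero j ρ)))
... | yes (j , ρ , p) = yes (insert zero j ρ , p)
... | no ¬p = no λ (π , p) →
  ¬p (π ⟨$⟩ʳ zero , remove zero π , resp (λ k → sym (insert-remove zero π k)) p)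

PairRel-swap : {H : PermPred n} {a b c d : Fin n} → PairRel H (a , b) (c , d) → PairRel H (b , a) (d , c)
PairRel-swap (h , Hh , ha , hb) = h , Hh , hb , ha

PairRel-≡ : {H : PermPred n} {x y x′ y′ : Fin n} → PairRel H (x , y) (x′ , y′) → x ≡ y → x′ ≡ y′
PairRel-≡ (h , _ , hx , hy) x≡y = trans (sym hx) (trans (cong (h ⟨$⟩ʳ_) x≡y) hy)

PairRel-Aut : {E : Fin n → Fin n → Set} {x y x′ y′ : Fin n} →
              PairRel (Aut E) (x , y) (x′ , y′) → E x y → E x′ y′
PairRel-Aut {E = E} (h , h-aut , hx , hy) e = subst₂ E hx hy (to (h-aut _ _) e)

module _ {G : PermPred n} (G-group : IsPermGroup G) where
  open IsPermGroup G-group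

  PairRel-refl : ∀ p → PairRel G p p
  PairRel-refl _ = id , has-id , refl , refl

  PairRel-sym : ∀ {p q} → PairRel G p q → PairRel G q p
  PairRel-sym (g , Gg , ga , gb) = flip g , inv Gg , flip-⟨$⟩ʳ g ga , flip-⟨$⟩ʳ g gb

  PairRel-trans : ∀ {p q r} → PairRel G p q → PairRel G q r → PairRel G p r
  PairRel-trans (g , Gg , ga , gb) (h , Hh , hc , hd) =
    g ∘ₚ h , closed Gg Hh , trans (cong (h ⟨$⟩ʳ_) ga) hc , trans (cong (h ⟨$⟩ʳ_) gb) hd

  PairRel? : ∀ {r} → HasRank G r → ∀ p q → Dec (PairRel G p q)
  PairRel? (rep , rep-distinct , rep-cover) p q with rep-cover p | rep-cover q
  ... | u , p~u | v , q~v with u ≟ v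
  ... | yes refl = yes (PairRel-trans p~u (PairRel-sym q~v))
  ... | no u≢v   = no λ p~q → u≢v (rep-distinct u v (PairRel-trans (PairRel-sym p~u) (PairRel-trans p~q q~v)))

  Aut-OrbitalGraph : ∀ α B {g} → G g → Aut (OrbitalGraph G α B) g
  Aut-OrbitalGraph α B {g} Gg x y = mk⇔
    (λ (h , β , Gh , Bβ , hα , hβ) → h ∘ₚ g , β , closed Gh Gg , Bβ , cong (g ⟨$⟩ʳ_) hα , cong (g ⟨$⟩ʳ_) hβ)
    (λ (h , β , Gh , Bβ , hα , hβ) →
      h ∘ₚ flip g , β , closed Gh (inv Gg) , Bβ , flip-⟨$⟩ʳ g (sym hα) , flip-⟨$⟩ʳ g (sym hβ))

  -- With g₁ a = α and g₂ (π a) = α, the element g₁⁻¹ π g₂ fixes α and maps g₁ b to g₂ (π b).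
  stabiliser⇒preservesOrbitals : Transitive G → {H : PermPred n} → IsPermGroup H → (∀ {g} → G g → H g) →
    ∀ α → (∀ {ρ} → H ρ → ρ ⟨$⟩ʳ α ≡ α → ∀ z → StabOrb G α z (ρ ⟨$⟩ʳ z)) →
    ∀ {π} → H π → ∀ a b → PairRel G (a , b) (π ⟨$⟩ʳ a , π ⟨$⟩ʳ b)
  stabiliser⇒preservesOrbitals G-trans H-group G⊆H α stab-preserves {π} Hπ a b
    with G-trans a α | G-trans (π ⟨$⟩ʳ a) α
  ... | g₁ , Gg₁ , g₁a | g₂ , Gg₂ , g₂πa =
    PairRel-trans (g₁ , Gg₁ , g₁a , refl)
      (PairRel-trans moved (PairRel-sym (g₂ , Gg₂ , g₂πa , refl)))
    where
      module H = IsPermGroup H-group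
      ρ : Permutation′ n
      ρ = flip g₁ ∘ₚ π ∘ₚ g₂
      ρα : ρ ⟨$⟩ʳ α ≡ α
      ρα = trans (cong (λ t → g₂ ⟨$⟩ʳ (π ⟨$⟩ʳ t)) (flip-⟨$⟩ʳ g₁ g₁a)) g₂πa
      moved : StabOrb G α (g₁ ⟨$⟩ʳ b) (g₂ ⟨$⟩ʳ (π ⟨$⟩ʳ b))
      moved = subst (λ t → StabOrb G α (g₁ ⟨$⟩ʳ b) (g₂ ⟨$⟩ʳ (π ⟨$⟩ʳ t))) (inverseˡ g₁)
                (stab-preserves (H.closed (H.inv (G⊆H Gg₁)) (H.closed Hπ (G⊆H Gg₂))) ρα (g₁ ⟨$⟩ʳ b))

Aut-isPermGroup : (E : Fin n → Fin n → Set) → IsPermGroup (Aut E)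
Aut-isPermGroup E = record
  { resp   = λ π≈ρ π-aut x y → mk⇔
      (λ e → subst₂ E (π≈ρ x) (π≈ρ y) (to (π-aut x y) e))
      (λ e → from (π-aut x y) (subst₂ E (sym (π≈ρ x)) (sym (π≈ρ y)) e))
  ; has-id = λ x y → mk⇔ (λ e → e) (λ e → e)
  ; closed = λ π-aut ρ-aut x y → mk⇔
      (λ e → to (ρ-aut _ _) (to (π-aut x y) e))
      (λ e → from (π-aut x y) (from (ρ-aut _ _) e))
  ; inv    = λ {π} π-aut x y → mk⇔
      (λ e → from (π-aut _ _) (subst₂ E (sym (inverseʳ π)) (sym (inverseʳ π)) e))
      (λ e → subst₂ E (inverseʳ π) (inverseʳ π) (to (π-aut _ _) e))
  }

does-≡⇒⇔ : ∀ {P Q : Set} (P? : Dec P) (Q? : Dec Q) → does P? ≡ does Q? → P ⇔ Q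
does-≡⇒⇔ (yes p) (yes q) _ = mk⇔ (λ _ → q) (λ _ → p)
does-≡⇒⇔ (no ¬p) (no ¬q) _ = mk⇔ (λ p → ⊥-elim (¬p p)) (λ q → ⊥-elim (¬q q))
does-≡⇒⇔ (yes _) (no _) ()
does-≡⇒⇔ (no _) (yes _) ()

IsAutOfDigraph-intro : {G : PermPred n} {E : Fin n → Fin n → Set} (E? : ∀ x y → Dec (E x y)) →
                       (∀ x → ¬ E x x) → (∀ π → G π ⇔ Aut E π) → IsAutOfDigraph G
IsAutOfDigraph-intro E? E-irrefl G⇔Aut =
  (λ x y → does (E? x y)) , (λ x → dec-false (E? x x) (E-irrefl x)) , λ π → mk⇔
    (λ Gπ x y → does-⇔ (to (G⇔Aut π) Gπ x y) (E? x y) (E? _ _))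
    (λ same → from (G⇔Aut π) λ x y → does-≡⇒⇔ (E? x y) (E? _ _) (same x y))

Primitive-mono : {G H : PermPred n} → (∀ {g} → G g → H g) → Primitive G → Primitive H
Primitive-mono G⊆H (G-trans , G-blocks) =
  (λ a b → let g , Gg , ga = G-trans a b in g , G⊆H Gg , ga) ,
  (λ C C-block → G-blocks C (λ g Gg → C-block g (G⊆H Gg)))

Primitive⇒block-trivial : {G : PermPred n} {C : Subset n} {x y z : Fin n} → Primitive G → IsBlock G C →
                          x ∈ C → y ∈ C → x ≢ y → z ∉ C → ⊥
Primitive⇒block-trivial {C = C} {x} {y} {z} (_ , G-blocks) C-block x∈C y∈C x≢y z∉C
  with G-blocks C C-block
... | inj₁ ∣C∣≤1 = ≤⇒≯ ∣C∣≤1 (subst (_< ∣ C ∣) (∣⁅x⁆∣≡1 x) (p⊂q⇒∣p∣<∣q∣ ⁅x⁆⊂C))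
  where
    ⁅x⁆⊂C : ⁅ x ⁆ ⊂ C
    ⁅x⁆⊂C = (λ w∈⁅x⁆ → subst (_∈ C) (sym (x∈⁅y⁆⇒x≡y x w∈⁅x⁆)) x∈C) , y , y∈C , x≢y⇒x∉⁅y⁆ (λ y≡x → x≢y (sym y≡x))
... | inj₂ ∣C∣≡n = z∉C (subst (z ∈_) (sym (∣p∣≡n⇒p≡⊤ ∣C∣≡n)) ∈⊤)

module _ {E : Fin n → Fin n → Set} (E? : ∀ x y → Dec (E x y)) (α : Fin n) where

  Star : Fin n → Set
  Star y = y ≡ α ⊎ E α y

  star : Subset n
  star = tabulate (λ y → does ((y ≟ α) ⊎-dec E? α y))

  Star⇒∈star : ∀ {y} → Star y → y ∈ star
  Star⇒∈star {y} s = lookup⇒[]= y star (trans (lookup∘tabulate _ y) (dec-true ((y ≟ α) ⊎-dec E? α y) s))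

  ∈star⇒Star : ∀ {y} → y ∈ star → Star y
  ∈star⇒Star {y} y∈ = toWitness {a? = (y ≟ α) ⊎-dec E? α y} (from T-≡
    (trans (isYes≗does _) (trans (sym (lookup∘tabulate _ y)) ([]=⇒lookup y∈))))

  -- An adjacency-closed star is connected, so it contains every image of itself that it meets.
  star-isBlock : {G : PermPred n} → (∀ {g} → G g → Aut E g) → (∀ x y → E x y → E y x) →
                 (∀ c d → Star c → E c d → Star d) → IsBlock G star
  star-isBlock G⊆Aut E-sym star-closed g Gg with (g ⟨$⟩ʳ α ≟ α) ⊎-dec E? α (g ⟨$⟩ʳ α)
  ... | yes gα∈ = inj₁ λ x x∈ → Star⇒∈star (image x (∈star⇒Star x∈))
    where
      image : ∀ x → Star x → Star (g ⟨$⟩ʳ x)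
      image x (inj₁ refl) = gα∈
      image x (inj₂ e)    = star-closed _ _ gα∈ (to (G⊆Aut Gg α x) e)
  ... | no gα∉ = inj₂ λ x x∈ gx∈ → meets x (∈star⇒Star x∈) (∈star⇒Star gx∈)
    where
      meets : ∀ x → Star x → Star (g ⟨$⟩ʳ x) → ⊥
      meets x (inj₁ refl) s = gα∉ s
      meets x (inj₂ e)    s = gα∉ (star-closed _ _ s (E-sym _ _ (to (G⊆Aut Gg α x) e)))

module _ {E : Fin n → Fin n → Set} where

  Walk-map : (f : Fin n → Fin n) → (∀ {x y} → E x y → E (f x) (f y)) →
             ∀ k {x y} → Walk E k x y → Walk E k (f x) (f y)
  Walk-map f f-hom zero    x≡y           = cong f x≡y
  Walk-map f f-hom (suc k) (z , e , walk) = f z , f-hom e , Walk-map f f-hom k walk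

  Dist-unique : ∀ {x y d d′} → Dist E x y d → Dist E x y d′ → d ≡ d′
  Dist-unique {d = d} {d′} (walk , shortest) (walk′ , shortest′) with <-cmp d d′
  ... | tri< d<d′ _ _ = ⊥-elim (shortest′ d d<d′ walk)
  ... | tri≈ _ d≡d′ _ = d≡d′
  ... | tri> _ _ d′<d = ⊥-elim (shortest d′ d′<d walk′)

  Dist-PairRel : ∀ {x y x′ y′ d} → PairRel (Aut E) (x , y) (x′ , y′) → Dist E x y d → Dist E x′ y′ d
  Dist-PairRel {d = d} (π , π-aut , πx , πy) (walk , shortest) =
    subst₂ (Walk E d) πx πy (Walk-map (π ⟨$⟩ʳ_) (λ {x} {y} → to (π-aut x y)) d walk) ,
    λ m m<d walk′ → shortest m m<d
      (subst₂ (Walk E m) (flip-⟨$⟩ʳ π πx) (flip-⟨$⟩ʳ π πy)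
        (Walk-map (flip π ⟨$⟩ʳ_) (λ {x} {y} → to (IsPermGroup.inv (Aut-isPermGroup E) {π} π-aut x y)) m walk′))

  Dist-0 : ∀ {x} → Dist E x x 0
  Dist-0 = refl , λ _ ()

  Dist-1 : ∀ {x y} → x ≢ y → E x y → Dist E x y 1
  Dist-1 {y = y} x≢y e = (y , e , refl) , λ { zero _ x≡y → x≢y x≡y ; (suc _) (s≤s ()) _ }

  Dist-2 : ∀ {x y c} → x ≢ y → ¬ E x y → E x c → E c y → Dist E x y 2
  Dist-2 {y = y} {c} x≢y ¬e e₁ e₂ = (c , e₁ , y , e₂ , refl) , λ
    { zero          _ x≡y               → x≢y x≡y
    ; (suc zero)    _ (_ , e , refl)    → ¬e e
    ; (suc (suc _)) (s≤s (s≤s ())) _ }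

other₁ other₂ : Fin 3 → Fin 3
other₁ zero = suc zero
other₁ (suc zero) = zero
other₁ (suc (suc zero)) = zero
other₂ zero = suc (suc zero)
other₂ (suc zero) = suc (suc zero)
other₂ (suc (suc zero)) = suc zero

other₁≢ : ∀ i → other₁ i ≢ i
other₁≢ zero ()
other₁≢ (suc zero) ()
other₁≢ (suc (suc zero)) ()

other₂≢ : ∀ i → other₂ i ≢ i
other₂≢ zero ()
other₂≢ (suc zero) ()
other₂≢ (suc (suc zero)) ()

other₁≢other₂ : ∀ i → other₁ i ≢ other₂ i
other₁≢other₂ zero ()
other₁≢other₂ (suc zero) ()
other₁≢other₂ (suc (suc zero)) ()

≢⇒other : ∀ i x → x ≢ i → x ≡ other₁ i ⊎ x ≡ other₂ i
≢⇒other zero zero x≢i = ⊥-elim (x≢i refl)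
≢⇒other zero (suc zero) _ = inj₁ refl
≢⇒other zero (suc (suc zero)) _ = inj₂ refl
≢⇒other (suc zero) zero _ = inj₁ refl
≢⇒other (suc zero) (suc zero) x≢i = ⊥-elim (x≢i refl)
≢⇒other (suc zero) (suc (suc zero)) _ = inj₂ refl
≢⇒other (suc (suc zero)) zero _ = inj₁ refl
≢⇒other (suc (suc zero)) (suc zero) _ = inj₂ refl
≢⇒other (suc (suc zero)) (suc (suc zero)) x≢i = ⊥-elim (x≢i refl)

-- The rank hypothesis serves only to make the orbital relation of G decidable.
module OrbitalGraphOfRank4
  {G : PermPred n} (G-group : IsPermGroup G) (G-primitive : Primitive G) (G-2closed : TwoClosed G)
  (G-rank : HasRank G 4) (G-notAut : ¬ IsAutOfDigraph G)
  (α : Fin n) (B : Fin 3 → Fin n → Set)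
  (B-orbit : ∀ j x → B j x → ∀ y → (B j y ⇔ StabOrb G α x y))
  (B-nonempty : ∀ j → ∃[ x ] B j x)
  (B-∌α : ∀ j → ¬ B j α)
  (B-disjoint : ∀ j l x → B j x → B l x → j ≡ l)
  (B-cover : ∀ y → y ≢ α → ∃[ j ] B j y)
  (i : Fin 3) where

  G-transitive : Transitive G
  G-transitive = proj₁ G-primitive

  x₀ : Fin 3 → Fin n
  x₀ j = proj₁ (B-nonempty j)

  B-x₀ : ∀ j → B j (x₀ j)
  B-x₀ j = proj₂ (B-nonempty j)

  B⇔StabOrb : ∀ j y → B j y ⇔ StabOrb G α (x₀ j) y
  B⇔StabOrb j = B-orbit j (x₀ j) (B-x₀ j)

  B? : ∀ j y → Dec (B j y)
  B? j y = map′ (from (B⇔StabOrb j y)) (to (B⇔StabOrb j y)) (PairRel? G-group G-rank _ _)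

  B⇒StabOrb : ∀ {j y z} → B j y → B j z → StabOrb G α y z
  B⇒StabOrb {j} By Bz =
    PairRel-trans G-group (PairRel-sym G-group (to (B⇔StabOrb j _) By)) (to (B⇔StabOrb j _) Bz)

  B⇒≢α : ∀ {j y} → B j y → y ≢ α
  B⇒≢α {j} By refl = B-∌α j By

  E : Fin n → Fin n → Set
  E = OrbitalGraph G α (B i)

  E⇒PairRel : ∀ {x y} → E x y → PairRel G (α , x₀ i) (x , y)
  E⇒PairRel (g , β , Gg , Bβ , gα , gβ) = PairRel-trans G-group (to (B⇔StabOrb i β) Bβ) (g , Gg , gα , gβ)

  PairRel⇒E : ∀ {x y} → PairRel G (α , x₀ i) (x , y) → E x y
  PairRel⇒E (g , Gg , gα , gx₀) = g , x₀ i , Gg , B-x₀ i , gα , gx₀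

  E? : ∀ x y → Dec (E x y)
  E? x y = map′ PairRel⇒E E⇒PairRel (PairRel? G-group G-rank _ _)

  E-α⇔B : ∀ y → E α y ⇔ B i y
  E-α⇔B y = mk⇔ (λ e → from (B⇔StabOrb i y) (E⇒PairRel e)) (λ By → PairRel⇒E (to (B⇔StabOrb i y) By))

  E-irreflexive : ∀ x → ¬ E x x
  E-irreflexive x e = B⇒≢α (B-x₀ i) (sym (PairRel-≡ (PairRel-sym G-group (E⇒PairRel e)) refl))

  A : PermPred n
  A = Aut E

  A-group : IsPermGroup A
  A-group = Aut-isPermGroup E

  G⊆A : ∀ {g} → G g → A g
  G⊆A = Aut-OrbitalGraph G-group α (B i)

  G⇒A : ∀ {p q} → PairRel G p q → PairRel A p q
  G⇒A (g , Gg , ga , gb) = g , G⊆A Gg , ga , gb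

  Other : Fin n → Set
  Other y = ∃[ j ] (j ≢ i × B j y)

  Other⇒¬B : ∀ {y} → Other y → ¬ B i y
  Other⇒¬B (j , j≢i , Bj) Bi = j≢i (B-disjoint j i _ Bj Bi)

  classify : ∀ y → y ≡ α ⊎ B i y ⊎ Other y
  classify y with y ≟ α | B? i y
  ... | yes y≡α | _     = inj₁ y≡α
  ... | no _    | yes b = inj₂ (inj₁ b)
  ... | no y≢α  | no ¬b with B-cover y y≢α
  ... | j , Bj = inj₂ (inj₂ (j , (λ { refl → ¬b Bj }) , Bj))

  x₁ x₂ : Fin n
  x₁ = x₀ (other₁ i)
  x₂ = x₀ (other₂ i)

  Fused : Set
  Fused = StabOrb A α x₁ x₂

  -- Deciding fusion by exhaustive search lets the contradiction in fused produce a fusing element.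
  Fused? : Dec Fused
  Fused? = ∃-Permutation? n
    (λ {π} {ρ} π≈ρ (π-aut , πα , πx) → IsPermGroup.resp A-group {π} {ρ} π≈ρ π-aut , trans (sym (π≈ρ α)) πα , trans (sym (π≈ρ x₁)) πx)
    (λ π → A? π ×-dec (π ⟨$⟩ʳ α ≟ α) ×-dec (π ⟨$⟩ʳ x₁ ≟ x₂))
    where
      A? : ∀ π → Dec (A π)
      A? π = all? λ x → all? λ y →
        map′ (λ (f , g) → mk⇔ f g) (λ e → to e , from e)
             ((E? x y →-dec E? _ _) ×-dec (E? _ _ →-dec E? x y))

  StabOrb-x₀ : ∀ {j l y z} → B j y → B l z → StabOrb A α y z → StabOrb A α (x₀ j) (x₀ l)
  StabOrb-x₀ By Bz y~z = PairRel-trans A-group (G⇒A (B⇒StabOrb (B-x₀ _) By))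
                           (PairRel-trans A-group y~z (G⇒A (B⇒StabOrb Bz (B-x₀ _))))

  StabOrb⇒Fused : ∀ {j l y z} → StabOrb A α y z → B j y → B l z → j ≢ l → j ≢ i → l ≢ i → Fused
  StabOrb⇒Fused {j} {l} y~z By Bz j≢l j≢i l≢i with ≢⇒other i j j≢i | ≢⇒other i l l≢i
  ... | inj₁ refl | inj₁ refl = ⊥-elim (j≢l refl)
  ... | inj₂ refl | inj₂ refl = ⊥-elim (j≢l refl)
  ... | inj₁ refl | inj₂ refl = StabOrb-x₀ By Bz y~z
  ... | inj₂ refl | inj₁ refl = PairRel-sym A-group (StabOrb-x₀ By Bz y~z)

  ¬Fused⇒B-invariant : ¬ Fused → ∀ {j l y z} → StabOrb A α y z → B j y → B l z → j ≡ l
  ¬Fused⇒B-invariant ¬fused {j} {l} {y} {z} y~z By Bz with j ≟ i | l ≟ i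
  ... | yes refl | _ = sym (B-disjoint l i z Bz (to (E-α⇔B z) (PairRel-Aut y~z (from (E-α⇔B y) By))))
  ... | _ | yes refl = B-disjoint j i y By
    (to (E-α⇔B y) (PairRel-Aut (PairRel-sym A-group y~z) (from (E-α⇔B z) Bz)))
  ... | no j≢i | no l≢i with j ≟ l
  ... | yes j≡l = j≡l
  ... | no j≢l  = ⊥-elim (¬fused (StabOrb⇒Fused y~z By Bz j≢l j≢i l≢i))

  ¬Fused⇒stabiliser-preserves : ¬ Fused → ∀ {ρ} → A ρ → ρ ⟨$⟩ʳ α ≡ α → ∀ z → StabOrb G α z (ρ ⟨$⟩ʳ z)
  ¬Fused⇒stabiliser-preserves ¬fused {ρ} ρ-aut ρα z with z ≟ α
  ... | yes refl = subst (StabOrb G α α) (sym ρα) (PairRel-refl G-group _)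
  ... | no z≢α with B-cover z z≢α | B-cover (ρ ⟨$⟩ʳ z) (λ ρz≡α → z≢α (⟨$⟩ʳ-injective ρ (trans ρz≡α (sym ρα))))
  ... | j , Bz | l , Bρz with ¬Fused⇒B-invariant ¬fused (ρ , ρ-aut , ρα , refl) Bz Bρz
  ... | refl = B⇒StabOrb Bz Bρz

  fused : Fused
  fused with Fused?
  ... | yes f = f
  ... | no ¬fused = ⊥-elim (G-notAut (IsAutOfDigraph-intro {E = E} E? E-irreflexive λ π → mk⇔ G⊆A
          λ π-aut → G-2closed π (stabiliser⇒preservesOrbitals G-group G-transitive A-group G⊆A α
                                   (λ {ρ} → ¬Fused⇒stabiliser-preserves ¬fused {ρ}) {π} π-aut)))

  Other-x₀ : ∀ {j} → j ≢ i → Other (x₀ j)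
  Other-x₀ {j} j≢i = j , j≢i , B-x₀ j

  Other⇒StabOrb : ∀ {y} → Other y → StabOrb A α y x₁
  Other⇒StabOrb {y} (j , j≢i , By) with ≢⇒other i j j≢i
  ... | inj₁ refl = G⇒A (B⇒StabOrb By (B-x₀ j))
  ... | inj₂ refl = PairRel-trans A-group (G⇒A (B⇒StabOrb By (B-x₀ j))) (PairRel-sym A-group fused)

  inNeighbours⇒StabOrb : ∀ {y z} → E y α → E z α → StabOrb G α y z
  inNeighbours⇒StabOrb ey ez =
    PairRel-swap (PairRel-trans G-group (PairRel-sym G-group (E⇒PairRel ey)) (E⇒PairRel ez))

  inNeighbour⇒B : ∀ {y} → E y α → B i y
  inNeighbour⇒B {y} e with classify y
  ... | inj₁ refl = ⊥-elim (E-irreflexive α e)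
  ... | inj₂ (inj₁ By) = By
  ... | inj₂ (inj₂ o) = ⊥-elim (other₁≢other₂ i (B-disjoint _ _ x₂ B₁x₂ (B-x₀ (other₂ i))))
    where
      e₁ : E x₁ α
      e₁ = PairRel-Aut (PairRel-swap (Other⇒StabOrb o)) e
      e₂ : E x₂ α
      e₂ = PairRel-Aut (PairRel-swap (PairRel-sym A-group (Other⇒StabOrb (Other-x₀ (other₂≢ i))))) e₁
      B₁x₂ : B (other₁ i) x₂
      B₁x₂ = from (B⇔StabOrb (other₁ i) _) (inNeighbours⇒StabOrb e₁ e₂)

  B⇒inNeighbour : ∀ {y} → B i y → E y α
  B⇒inNeighbour By with G-transitive (x₀ i) α
  ... | g , Gg , gx₀ = PairRel-Aut (PairRel-swap (G⇒A (B⇒StabOrb (inNeighbour⇒B e) By))) e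
    where
      e : E (g ⟨$⟩ʳ α) α
      e = PairRel⇒E (g , Gg , refl , gx₀)

  E-sym : ∀ x y → E x y → E y x
  E-sym x y e with G-transitive x α
  ... | g , Gg , gx = PairRel-Aut (PairRel-swap (PairRel-sym A-group (g , G⊆A Gg , gx , refl)))
    (B⇒inNeighbour (to (E-α⇔B _) (PairRel-Aut (g , G⊆A Gg , gx , refl) e)))

  common-neighbour : ∃[ c ] (E α c × E c x₁)
  common-neighbour with any? (λ c → E? α c ×-dec E? c x₁)
  ... | yes found = found
  ... | no none = ⊥-elim (Primitive⇒block-trivial G-primitive
          (star-isBlock E? α G⊆A E-sym star-closed)
          (Star⇒∈star E? α (inj₁ refl)) (Star⇒∈star E? α (inj₂ (from (E-α⇔B _) (B-x₀ i))))
          (λ α≡x₀ → B⇒≢α (B-x₀ i) (sym α≡x₀))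
          (λ x₁∈ → x₁∉ (∈star⇒Star E? α x₁∈)))
    where
      x₁∉ : ¬ Star E? α x₁
      x₁∉ (inj₁ x₁≡α) = B⇒≢α (B-x₀ (other₁ i)) x₁≡α
      x₁∉ (inj₂ e)    = Other⇒¬B (Other-x₀ (other₁≢ i)) (to (E-α⇔B _) e)
      star-closed : ∀ c d → Star E? α c → E c d → Star E? α d
      star-closed c d (inj₁ refl) e = inj₂ e
      star-closed c d (inj₂ eαc) e with classify d
      ... | inj₁ d≡α = inj₁ d≡α
      ... | inj₂ (inj₁ Bd) = inj₂ (from (E-α⇔B d) Bd)
      ... | inj₂ (inj₂ o) with Other⇒StabOrb o
      ... | h , h-aut , hα , hd =
        ⊥-elim (none (h ⟨$⟩ʳ c , PairRel-Aut (h , h-aut , hα , refl) eαc , PairRel-Aut (h , h-aut , refl , hd) e))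

  Suborbit : Fin 3 → Fin n → Set
  Suborbit zero y = y ≡ α
  Suborbit (suc zero) y = B i y
  Suborbit (suc (suc zero)) y = Other y

  centre : Fin 3 → Fin n
  centre zero = α
  centre (suc zero) = x₀ i
  centre (suc (suc zero)) = x₁

  Suborbit-centre : ∀ u → Suborbit u (centre u)
  Suborbit-centre zero = refl
  Suborbit-centre (suc zero) = B-x₀ i
  Suborbit-centre (suc (suc zero)) = Other-x₀ (other₁≢ i)

  suborbit : ∀ y → ∃[ u ] Suborbit u y
  suborbit y with classify y
  ... | inj₁ y≡α = zero , y≡α
  ... | inj₂ (inj₁ By) = suc zero , By
  ... | inj₂ (inj₂ o) = suc (suc zero) , o

  Suborbit⇒StabOrb : ∀ u {y z} → Suborbit u y → Suborbit u z → StabOrb A α y z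
  Suborbit⇒StabOrb zero refl refl = PairRel-refl A-group _
  Suborbit⇒StabOrb (suc zero) By Bz = G⇒A (B⇒StabOrb By Bz)
  Suborbit⇒StabOrb (suc (suc zero)) oy oz =
    PairRel-trans A-group (Other⇒StabOrb oy) (PairRel-sym A-group (Other⇒StabOrb oz))

  Dist-Suborbit : ∀ u {y} → Suborbit u y → Dist E α y (toℕ u)
  Dist-Suborbit zero refl = Dist-0
  Dist-Suborbit (suc zero) By = Dist-1 (λ α≡y → B⇒≢α By (sym α≡y)) (from (E-α⇔B _) By)
  Dist-Suborbit (suc (suc zero)) {y} o@(_ , _ , By) with common-neighbour | PairRel-sym A-group (Other⇒StabOrb o)
  ... | c , eαc , ecx₁ | h , h-aut , hα , hx₁ =
    Dist-2 (λ α≡y → B⇒≢α By (sym α≡y)) (λ e → Other⇒¬B o (to (E-α⇔B y) e))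
           (PairRel-Aut (h , h-aut , hα , refl) eαc) (PairRel-Aut (h , h-aut , refl , hx₁) ecx₁)

  Dist-unique-Suborbit : ∀ u v {y} → Dist E α y (toℕ u) → Suborbit v y → u ≡ v
  Dist-unique-Suborbit u v d sv = toℕ-injective (Dist-unique d (Dist-Suborbit v sv))

  StabOrb⇔Suborbit : ∀ u {x} → Suborbit u x → ∀ y → StabOrb A α x y ⇔ Suborbit u y
  StabOrb⇔Suborbit u su y = mk⇔
    (λ x~y → let v , sv = suborbit y in
      subst (λ w → Suborbit w y) (sym (Dist-unique-Suborbit u v (Dist-PairRel x~y (Dist-Suborbit u su)) sv)) sv)
    (Suborbit⇒StabOrb u su)

  normal-form : ∀ x y → ∃[ u ] PairRel A (x , y) (α , centre u)
  normal-form x y with G-transitive x α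
  ... | g , Gg , gx with suborbit (g ⟨$⟩ʳ y)
  ... | u , su = u , PairRel-trans A-group (g , G⊆A Gg , gx , refl) (Suborbit⇒StabOrb u su (Suborbit-centre u))

  Dist-normal-form : ∀ {x y} u → PairRel A (x , y) (α , centre u) → Dist E x y (toℕ u)
  Dist-normal-form u xy~ = Dist-PairRel (PairRel-sym A-group xy~) (Dist-Suborbit u (Suborbit-centre u))

  A-rank3 : HasRank A 3
  A-rank3 =
    (λ u → α , centre u) ,
    (λ u v u~v → Dist-unique-Suborbit u v (Dist-PairRel u~v (Dist-Suborbit u (Suborbit-centre u))) (Suborbit-centre v)) ,
    λ (x , y) → normal-form x y

  E-distanceTransitive : DistanceTransitive E
  E-distanceTransitive x y x′ y′ d dxy dx′y′ with normal-form x y | normal-form x′ y′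
  ... | u , xy~ | u′ , x′y′~
    with toℕ-injective (trans (Dist-unique (Dist-normal-form u xy~) dxy)
                              (sym (Dist-unique (Dist-normal-form u′ x′y′~) dx′y′)))
  ... | refl = PairRel-trans A-group xy~ (PairRel-sym A-group x′y′~)

  E-diameter2 : HasDiameter E 2
  E-diameter2 =
    (λ x y → let u , xy~ = normal-form x y in toℕ u , toℕ≤pred[n] u , Dist-normal-form u xy~) ,
    α , x₁ , Dist-Suborbit (suc (suc zero)) (Suborbit-centre (suc (suc zero)))

lemma4p2 : (n : ℕ) → n ≥ 4096 → (α : Fin n) → (G : PermPred n) → IsPermGroup G →
    Primitive G → TwoClosed G → HasRank G 4 → ¬ IsAutOfDigraph G →
    (B : Fin 3 → Fin n → Set) →
    (∀ i x → B i x → ∀ y → (B i y ⇔ StabOrb G α x y)) →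
    (∀ i → ∃[ x ] B i x) →
    (∀ i → ¬ B i α) →
    (∀ i j x → B i x → B j x → i ≡ j) →
    (∀ y → y ≢ α → ∃[ i ] B i y) →
    ∀ i →
      (Primitive (Aut (OrbitalGraph G α (B i)))
        × HasRank (Aut (OrbitalGraph G α (B i))) 3
        × (∀ y → StabOrb (Aut (OrbitalGraph G α (B i))) α α y ⇔ (y ≡ α))
        × (∀ x → B i x → ∀ y →
             StabOrb (Aut (OrbitalGraph G α (B i))) α x y ⇔ B i y)
        × (∀ x → (∃[ j ] (j ≢ i × B j x)) → ∀ y →
             StabOrb (Aut (OrbitalGraph G α (B i))) α x y ⇔ (∃[ j ] (j ≢ i × B j y))))
      × (UndirectedGraph (OrbitalGraph G α (B i))
        × DistanceTransitive (OrbitalGraph G α (B i))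
        × HasDiameter (OrbitalGraph G α (B i)) 2)
lemma4p2 n _ α G G-group G-primitive G-2closed G-rank G-notAut B B-orbit B-nonempty B-∌α B-disjoint B-cover i =
  ( ( Primitive-mono G⊆A G-primitive
    , A-rank3
    , StabOrb⇔Suborbit zero refl
    , (λ _ → StabOrb⇔Suborbit (suc zero))
    , (λ _ → StabOrb⇔Suborbit (suc (suc zero))) )
  , ( (E-sym , E-irreflexive)
    , E-distanceTransitive
    , E-diameter2 ) )
  where
    open OrbitalGraphOfRank4 G-group G-primitive G-2closed G-rank G-notAut α B B-orbit B-nonempty B-∌α B-disjoint B-cover i
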